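{- The only solution of the equation $2^{2r-3} - 2^r + 1 = 97^s$ in positive integers $r,s$ with $r\ge 5$ is $(r,s)=(5,1)$. -}

module Defs where

{-# OPTIONS --safe #-}
-- Since 97 = 1 + 2⁵·3, lifting the exponent gives v₂(97ˢ − 1) = 5 + v₂(s).  Writing
-- r = 5 + k, the equation says 97ˢ − 1 = 2^(5+k)·(2^(2+k) − 1), so v₂(97ˢ − 1) = 5 + k
-- and hence 2ᵏ divides s.  Then s > k, and unless s = 1 we get
-- 97ˢ > 2^(6s) ≥ 2^(2k+7) > 97ˢ − 1, which is absurd; finally s = 1 forces k = 0.
module Submission where

open import Defs
open import Data.Nat using (ℕ; _+_; _*_; _∸_; _^_; _≤_; _≥_; _<_; zero; suc; s≤s; z≤n; z<s)
open import Data.Nat.Properties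
open import Data.Nat.Induction using (<-rec)
open import Data.Nat.Tactic.RingSolver using (solve-∀)
open import Data.Product using (_×_; _,_; ∃; ∃₂)
open import Data.Sum using (_⊎_; inj₁; inj₂)
open import Data.Empty using (⊥-elim)
open import Relation.Binary.PropositionalEquality
open import Function using (_$_)

even⊎odd : ∀ n → ∃ λ h → n ≡ 2 * h ⊎ n ≡ 1 + 2 * h
even⊎odd zero = 0 , inj₁ refl
even⊎odd (suc n) with even⊎odd n
... | h , inj₁ n≡2h = h , inj₂ (cong suc n≡2h)
... | h , inj₂ n≡1+2h = suc h , inj₁ (trans (cong suc n≡1+2h) (cong suc (sym (+-suc h (h + 0)))))

n<2^n : ∀ n → n < 2 ^ n
n<2^n zero = z<s
n<2^n (suc n) = +-mono-≤ (m^n>0 2 n) (≤-trans (n<2^n n) (m≤m+n (2 ^ n) 0))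

2^[6n]<97^n : ∀ n → 1 ≤ n → 2 ^ (6 * n) < 97 ^ n
2^[6n]<97^n n@(suc _) _ = begin-strict
  2 ^ (6 * n) ≡⟨ sym (^-*-assoc 2 6 n) ⟩
  64 ^ n      <⟨ ^-monoˡ-< n (m<n+m 64 {33} z<s) ⟩
  97 ^ n      ∎
  where open ≤-Reasoning

odd-decomposition : ∀ n → 0 < n → ∃₂ λ j t → n ≡ 2 ^ j * (1 + 2 * t)
odd-decomposition = <-rec _ decompose
  where
  decompose : ∀ n → (∀ {m} → m < n → 0 < m → ∃₂ λ j t → m ≡ 2 ^ j * (1 + 2 * t)) →
              0 < n → ∃₂ λ j t → n ≡ 2 ^ j * (1 + 2 * t)
  decompose n rec 0<n with even⊎odd n
  ... | t , inj₂ n≡odd = 0 , t , trans n≡odd (sym (+-identityʳ _))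
  ... | zero , inj₁ refl = ⊥-elim (<-irrefl refl 0<n)
  ... | h@(suc _) , inj₁ refl with rec (m<m+n h z<s) z<s
  ...   | j , t , h≡ = suc j , t , trans (cong (2 *_) h≡) (sym (*-assoc 2 (2 ^ j) _))

2^a*odd≡2^b*odd⇒a≡b : ∀ a b x y → 2 ^ a * (1 + 2 * x) ≡ 2 ^ b * (1 + 2 * y) → a ≡ b
2^a*odd≡2^b*odd⇒a≡b zero zero x y eq = refl
2^a*odd≡2^b*odd⇒a≡b zero (suc b) x y eq = ⊥-elim (even≢odd (2 ^ b * (1 + 2 * y)) x (begin
  2 * (2 ^ b * (1 + 2 * y)) ≡⟨ *-assoc 2 (2 ^ b) (1 + 2 * y) ⟨
  2 ^ suc b * (1 + 2 * y)   ≡⟨ eq ⟨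
  1 * (1 + 2 * x)           ≡⟨ *-identityˡ (1 + 2 * x) ⟩
  1 + 2 * x                 ∎))
  where open ≡-Reasoning
2^a*odd≡2^b*odd⇒a≡b (suc a) zero x y eq =
  sym (2^a*odd≡2^b*odd⇒a≡b zero (suc a) y x (sym eq))
2^a*odd≡2^b*odd⇒a≡b (suc a) (suc b) x y eq = cong suc (2^a*odd≡2^b*odd⇒a≡b a b x y (*-cancelˡ-≡ _ _ 2 (begin
  2 * (2 ^ a * (1 + 2 * x)) ≡⟨ *-assoc 2 (2 ^ a) (1 + 2 * x) ⟨
  2 ^ suc a * (1 + 2 * x)   ≡⟨ eq ⟩
  2 ^ suc b * (1 + 2 * y)   ≡⟨ *-assoc 2 (2 ^ b) (1 + 2 * y) ⟩
  2 * (2 ^ b * (1 + 2 * y)) ∎)))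
  where open ≡-Reasoning

-- x = 1 + 2ᵐ·(odd), i.e. the 2-adic valuation of x − 1 is exactly m
data Val₂-1 (x m : ℕ) : Set where
  val₂-1 : ∀ a → x ≡ 1 + 2 ^ m * (1 + 2 * a) → Val₂-1 x m

Val₂-1-unique : ∀ {x m n} → Val₂-1 x m → Val₂-1 x n → m ≡ n
Val₂-1-unique (val₂-1 a refl) (val₂-1 b eq) = 2^a*odd≡2^b*odd⇒a≡b _ _ a b (+-cancelˡ-≡ 1 _ _ eq)

Val₂-1-^2 : ∀ {x m} → Val₂-1 x (2 + m) → Val₂-1 (x ^ 2) (3 + m)
Val₂-1-^2 {m = m} (val₂-1 a refl) =
  val₂-1 (a + 2 ^ m * ((1 + 2 * a) * (1 + 2 * a))) $ trans (cong (x *_) (*-identityʳ x)) (square (2 ^ m) a)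
  where
  x = 1 + 2 ^ (2 + m) * (1 + 2 * a)
  square : ∀ Q a → (1 + 2 * (2 * Q) * (1 + 2 * a)) * (1 + 2 * (2 * Q) * (1 + 2 * a))
                 ≡ 1 + 2 * (2 * (2 * Q)) * (1 + 2 * (a + Q * ((1 + 2 * a) * (1 + 2 * a))))
  square = solve-∀

Val₂-1-^2^ : ∀ {x m} → Val₂-1 x (2 + m) → ∀ j → Val₂-1 (x ^ 2 ^ j) (2 + m + j)
Val₂-1-^2^ {x} {m} v zero = subst (λ y → Val₂-1 y (2 + m + 0)) (sym (*-identityʳ x))
                                  (subst (Val₂-1 x) (sym (+-identityʳ (2 + m))) v)
Val₂-1-^2^ {x} {m} v (suc j) = subst₂ Val₂-1 x^2^j^2≡x^2^[1+j] (cong (2 +_) (sym (+-suc m j)))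
                                     (Val₂-1-^2 (Val₂-1-^2^ v j))
  where
  open ≡-Reasoning
  x^2^j^2≡x^2^[1+j] : (x ^ 2 ^ j) ^ 2 ≡ x ^ 2 ^ suc j
  x^2^j^2≡x^2^[1+j] = begin
    (x ^ 2 ^ j) ^ 2 ≡⟨ ^-*-assoc x (2 ^ j) 2 ⟩
    x ^ (2 ^ j * 2) ≡⟨ cong (x ^_) (*-comm (2 ^ j) 2) ⟩
    x ^ 2 ^ suc j   ∎

Val₂-1-^odd : ∀ {x m} → Val₂-1 x (suc m) → ∀ t → Val₂-1 (x ^ (1 + 2 * t)) (suc m)
Val₂-1-^odd (val₂-1 a refl) zero = val₂-1 a (*-identityʳ _)
Val₂-1-^odd {x} {m} v@(val₂-1 a refl) (suc t) with Val₂-1-^odd v t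
... | val₂-1 c x^[1+2t]≡ = val₂-1 (c + W + 2 * Q * W * (1 + 2 * c)) (begin
  x ^ (1 + 2 * suc t)        ≡⟨ cong (x ^_) (exponent t) ⟩
  x * (x * x ^ (1 + 2 * t))  ≡⟨ cong (λ y → x * (x * y)) x^[1+2t]≡ ⟩
  x * (x * (1 + 2 * Q * (1 + 2 * c))) ≡⟨ cube Q a c ⟩
  1 + 2 * Q * (1 + 2 * (c + W + 2 * Q * W * (1 + 2 * c))) ∎)
  where
  open ≡-Reasoning
  Q = 2 ^ m
  W = (1 + 2 * a) + Q * ((1 + 2 * a) * (1 + 2 * a))
  exponent : ∀ t → 1 + 2 * suc t ≡ 2 + (1 + 2 * t)
  exponent = solve-∀
  cube : ∀ Q a c → let W = (1 + 2 * a) + Q * ((1 + 2 * a) * (1 + 2 * a)) in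
         (1 + 2 * Q * (1 + 2 * a)) * ((1 + 2 * Q * (1 + 2 * a)) * (1 + 2 * Q * (1 + 2 * c)))
         ≡ 1 + 2 * Q * (1 + 2 * (c + W + 2 * Q * W * (1 + 2 * c)))
  cube = solve-∀

Val₂-1-^ : ∀ {x m} → Val₂-1 x (2 + m) → ∀ j t → Val₂-1 (x ^ (2 ^ j * (1 + 2 * t))) (2 + m + j)
Val₂-1-^ {x} v j t = subst (λ y → Val₂-1 y _) (^-*-assoc x (2 ^ j) (1 + 2 * t))
                           (Val₂-1-^odd (Val₂-1-^2^ v j) t)

Val₂-1-97 : Val₂-1 97 5
Val₂-1-97 = val₂-1 1 refl

x+2^n≡2^[n+1+k]+1⇒Val₂-1 : ∀ x n k → x + 2 ^ n ≡ 2 ^ (n + suc k) + 1 → Val₂-1 x n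
x+2^n≡2^[n+1+k]+1⇒Val₂-1 x n k eq with m≤n⇒∃[o]m+o≡n (m^n>0 2 k)
... | o , 1+o≡2^k = val₂-1 o $ +-cancelʳ-≡ (2 ^ n) _ _ (begin
  x + 2 ^ n                           ≡⟨ eq ⟩
  2 ^ (n + suc k) + 1                 ≡⟨ cong (_+ 1) (^-distribˡ-+-* 2 n (suc k)) ⟩
  2 ^ n * (2 * 2 ^ k) + 1             ≡⟨ cong (λ y → 2 ^ n * (2 * y) + 1) (sym 1+o≡2^k) ⟩
  2 ^ n * (2 * (1 + o)) + 1           ≡⟨ split (2 ^ n) o ⟩
  1 + 2 ^ n * (1 + 2 * o) + 2 ^ n     ∎)
  where
  open ≡-Reasoning
  split : ∀ P o → P * (2 * (1 + o)) + 1 ≡ 1 + P * (1 + 2 * o) + P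
  split = solve-∀

2^[2k+7]<97^s : ∀ k s → k < s → 2 ≤ s → 2 ^ ((5 + k) + (2 + k)) < 97 ^ s
2^[2k+7]<97^s k s k<s 2≤s = begin-strict
  2 ^ ((5 + k) + (2 + k)) ≤⟨ ^-monoʳ-≤ 2 exponent-bound ⟩
  2 ^ (6 * s)             <⟨ 2^[6n]<97^n s (≤-trans (s≤s z≤n) 2≤s) ⟩
  97 ^ s                  ∎
  where
  open ≤-Reasoning
  regroup : ∀ k → (5 + k) + (2 + k) + 3 ≡ 2 * suc k + 4 * 2
  regroup = solve-∀
  six : ∀ s → 2 * s + 4 * s ≡ 6 * s
  six = solve-∀
  exponent-bound : (5 + k) + (2 + k) ≤ 6 * s
  exponent-bound = begin
    (5 + k) + (2 + k)     ≤⟨ m≤m+n _ 3 ⟩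
    (5 + k) + (2 + k) + 3 ≡⟨ regroup k ⟩
    2 * suc k + 4 * 2     ≤⟨ +-mono-≤ (*-monoʳ-≤ 2 k<s) (*-monoʳ-≤ 4 2≤s) ⟩
    2 * s + 4 * s         ≡⟨ six s ⟩
    6 * s                 ∎

97^s≤2^[2k+7]⇒s≡1 : ∀ k s → k < s → 97 ^ s ≤ 2 ^ ((5 + k) + (2 + k)) → s ≡ 1
97^s≤2^[2k+7]⇒s≡1 k (suc zero) _ _ = refl
97^s≤2^[2k+7]⇒s≡1 k s@(suc (suc _)) k<s le = ⊥-elim (<⇒≱ (2^[2k+7]<97^s k s k<s (s≤s (s≤s z≤n))) le)

lemma4p2 : (2 ^ (2 * 5 ∸ 3) + 1 ≡ 97 ^ 1 + 2 ^ 5)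
    × ((r s : ℕ) → r ≥ 5 → 1 ≤ s →
    2 ^ (2 * r ∸ 3) + 1 ≡ 97 ^ s + 2 ^ r →
    (r ≡ 5 × s ≡ 1))
lemma4p2 = refl , solutions
  where
  exponent : ∀ k → 2 * (5 + k) ∸ 3 ≡ (5 + k) + (2 + k)
  exponent k = cong (_∸ 3) (double k)
    where
    double : ∀ k → 2 * (5 + k) ≡ 3 + ((5 + k) + (2 + k))
    double = solve-∀

  solutions : (r s : ℕ) → r ≥ 5 → 1 ≤ s → 2 ^ (2 * r ∸ 3) + 1 ≡ 97 ^ s + 2 ^ r → r ≡ 5 × s ≡ 1
  solutions r s r≥5 0<s eq
    with k , refl ← m≤n⇒∃[o]m+o≡n r≥5
       | j , t , refl ← odd-decomposition s 0<s
    with eq′ ← trans (sym eq) (cong (λ e → 2 ^ e + 1) (exponent k))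
    with refl ← +-cancelˡ-≡ 5 j k (Val₂-1-unique (Val₂-1-^ Val₂-1-97 j t)
                                                (x+2^n≡2^[n+1+k]+1⇒Val₂-1 _ (5 + k) (1 + k) eq′))
    = cong (5 +_) (2^a*odd≡2^b*odd⇒a≡b j 0 t 0 s≡1) , s≡1
    where
    s≡1 : 2 ^ j * (1 + 2 * t) ≡ 1
    s≡1 = 97^s≤2^[2k+7]⇒s≡1 j _ (≤-trans (n<2^n j) (m≤m*n (2 ^ j) (1 + 2 * t))) 97^s≤2^[2k+7]
      where
      97^s≤2^[2k+7] : 97 ^ (2 ^ j * (1 + 2 * t)) ≤ 2 ^ ((5 + j) + (2 + j))
      97^s≤2^[2k+7] = +-cancelʳ-≤ 1 _ _ (≤-trans (+-monoʳ-≤ _ (m^n>0 2 (5 + j))) (≤-reflexive eq′))
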